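{- Let $X$ be an indeterminate and work in $\mathbb{Q}(X)$. For integers $j\ge 0$ put \[ a_j=\sum_h\binom{j+1+h}{2h+1}X^h,\qquad b_j=\sum_h\binom{j+1+h}{2h}X^h . \] For a positive integer $n$ let $N$ be the $n\times n$ matrix with entries \[ N_{i,j}=\binom{j}{i}X+\binom{j+2}{i+1},\qquad 0\le i,j<n \] (the transpose of $\bigl(\binom{i}{j}X+\binom{i+2}{j+1}\bigr)_{0\le i,j<n}$). Define $n\times n$ matrices $L$ and $U$ (indices $0,\dots,n-1$) by \[ L_{i,i}=1,\qquad L_{i,i-1}=\frac{\sum_h\binom{i+h}{2h+1}X^h}{\sum_h\binom{i+1+h}{2h+1}X^h}\ \ (i\ge1),\qquad L_{i,j}=0 \text{ otherwise}, \] \[ U_{j,l}=\frac{\binom{l+1}{j+1}a_j+\binom{l}{j}b_j}{a_j}. \] Then $N=LU$.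
   Context: Sums over $h$ run over all integers $h$ with finitely many nonzero terms; binomial coefficients $\binom ab$ with $a,b$ nonnegative integers are the usual ones, zero when $b>a$ or $b<0$ (so $U_{j,l}=0$ for $j>l$). -}

module Defs where

open import Data.Nat as ℕ using (ℕ; zero; suc; _∸_)
open import Data.Nat.Combinatorics using (_C_)
open import Data.Integer as ℤ using (ℤ; +_)
open import Data.Fin using (Fin; toℕ) renaming (zero to fzero; suc to fsuc)
open import Data.Product using (_×_; _,_; proj₁; proj₂)
open import Relation.Nullary using (yes; no)
open import Relation.Binary.PropositionalEquality using (_≡_)

-- A polynomial p is represented by  k ↦ (coefficient of X^k).
-- (All polynomials used below have finitely many nonzero coefficients.)

Poly : Set
Poly = ℕ → ℤ

_≈ₚ_ : Poly → Poly → Set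
p ≈ₚ q = ∀ k → p k ≡ q k

sumTo : ℕ → (ℕ → ℤ) → ℤ
sumTo zero    f = f zero
sumTo (suc k) f = sumTo k f ℤ.+ f (suc k)

constP : ℤ → Poly
constP c zero    = c
constP c (suc k) = + 0

Xp : Poly
Xp zero          = + 0
Xp (suc zero)    = + 1
Xp (suc (suc k)) = + 0

_+ₚ_ : Poly → Poly → Poly
(p +ₚ q) k = p k ℤ.+ q k

_*ₚ_ : Poly → Poly → Poly
(p *ₚ q) k = sumTo k (λ i → p i ℤ.* q (k ∸ i))

-- ℚ(X) = field of fractions of ℤ[X]: an element is a pair (num , den)
-- with den ≠ 0; equality is cross-multiplication.

Frac : Set
Frac = Poly × Poly

_/ₚ_ : Poly → Poly → Frac
p /ₚ q = p , q

_≈_ : Frac → Frac → Set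
(p , q) ≈ (r , s) = (p *ₚ s) ≈ₚ (r *ₚ q)

_+f_ : Frac → Frac → Frac
(p , q) +f (r , s) = ((p *ₚ s) +ₚ (r *ₚ q)) , (q *ₚ s)

_*f_ : Frac → Frac → Frac
(p , q) *f (r , s) = (p *ₚ r) , (q *ₚ s)

0f 1f : Frac
0f = constP (+ 0) , constP (+ 1)
1f = constP (+ 1) , constP (+ 1)

Mat : ℕ → Set
Mat n = Fin n → Fin n → Frac

sumFin : ∀ n → (Fin n → Frac) → Frac
sumFin zero    f = 0f
sumFin (suc n) f = f fzero +f sumFin n (λ i → f (fsuc i))

_⊗_ : ∀ {n} → Mat n → Mat n → Mat n
(A ⊗ B) i l = sumFin _ (λ j → A i j *f B j l)

binom : ℕ → ℕ → ℤ
binom m k = + (m C k)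

a : ℕ → Poly
a j h = binom (j ℕ.+ 1 ℕ.+ h) (2 ℕ.* h ℕ.+ 1)

b : ℕ → Poly
b j h = binom (j ℕ.+ 1 ℕ.+ h) (2 ℕ.* h)

Nmat : ∀ n → Mat n
Nmat n i j =
  ((constP (binom (toℕ j) (toℕ i)) *ₚ Xp) +ₚ constP (binom (toℕ j ℕ.+ 2) (toℕ i ℕ.+ 1))) /ₚ constP (+ 1)

Lnum : ℕ → Poly
Lnum i h = binom (i ℕ.+ h) (2 ℕ.* h ℕ.+ 1)

Lden : ℕ → Poly
Lden i h = binom (i ℕ.+ 1 ℕ.+ h) (2 ℕ.* h ℕ.+ 1)

Lmat : ∀ n → Mat n
Lmat n i j with toℕ i ℕ.≟ toℕ j
... | yes _ = 1f
... | no _ with toℕ i ℕ.≟ suc (toℕ j)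
...   | yes _ = Lnum (toℕ i) /ₚ Lden (toℕ i)
...   | no _  = 0f

Umat : ∀ n → Mat n
Umat n j l =
  ((constP (binom (toℕ l ℕ.+ 1) (toℕ j ℕ.+ 1)) *ₚ a (toℕ j))
     +ₚ (constP (binom (toℕ l) (toℕ j)) *ₚ b (toℕ j)))
  /ₚ a (toℕ j)

module Submission where

-- Row i of L has at most two nonzero entries, L_{i,i} = 1 and
-- L_{i,i-1} = a_{i-1} / a_i.  Hence row i of L U is U_{0,l} for i = 0 and
-- (a_{t}/a_{t+1}) U_{t,l} + U_{t+1,l} for i = t + 1; writing
-- U_{t,l} = u_{t,l} / a_t this is u_{0,l}/a_0, resp. (u_{t,l} + u_{t+1,l})/a_{t+1}.
-- The theorem thus reduces to the two polynomial identities
--     N_{0,l} a_0 = u_{0,l},     N_{t+1,l} a_{t+1} = u_{t,l} + u_{t+1,l},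
-- which follow by ring normalisation from the Pascal recurrences
--     a_0 = 1,  b_0 = 1 + X,  a_{t+1} = a_t + b_t,  b_{t+1} = b_t + X a_{t+1}
-- and Pascal's rule for the scalar binomials.

open import Defs
open import Data.Nat as ℕ using (ℕ; zero; suc; _∸_; _≤_; _<_; z≤n; s≤s)
import Data.Nat.Properties as ℕP
open import Data.Nat.Combinatorics using (k>n⇒nCk≡0; nCk+nC[k+1]≡[n+1]C[k+1])
open import Data.Integer as ℤ using (ℤ; +_)
import Data.Integer.Properties as ℤP
open import Data.Fin using (Fin; toℕ; inject₁) renaming (zero to fzero; suc to fsuc)
open import Data.Fin.Properties using (toℕ-inject₁)
open import Data.Product using (_,_; proj₁; proj₂)
open import Data.Empty using (⊥-elim)
open import Function using (_∘_)
open import Relation.Nullary using (yes; no)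
open import Relation.Binary.PropositionalEquality
open import Algebra.Bundles using (CommutativeSemiring)
open import Relation.Binary.Structures using (IsEquivalence)
open import Algebra.Properties.CommutativeSemigroup ℤP.+-commutativeSemigroup using (interchange)

sumTo-cong : ∀ k {f g : ℕ → ℤ} → (∀ i → i ≤ k → f i ≡ g i) → sumTo k f ≡ sumTo k g
sumTo-cong zero    e = e 0 z≤n
sumTo-cong (suc k) e =
  cong₂ ℤ._+_ (sumTo-cong k (λ i i≤k → e i (ℕP.m≤n⇒m≤1+n i≤k))) (e (suc k) ℕP.≤-refl)

sumTo-+ : ∀ k (f g : ℕ → ℤ) → sumTo k (λ i → f i ℤ.+ g i) ≡ sumTo k f ℤ.+ sumTo k g
sumTo-+ zero    f g = refl
sumTo-+ (suc k) f g =
  trans (cong (ℤ._+ (f (suc k) ℤ.+ g (suc k))) (sumTo-+ k f g))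
        (interchange (sumTo k f) (sumTo k g) (f (suc k)) (g (suc k)))

sumTo-scale : ∀ k c (f : ℕ → ℤ) → sumTo k (λ i → c ℤ.* f i) ≡ c ℤ.* sumTo k f
sumTo-scale zero    c f = refl
sumTo-scale (suc k) c f =
  trans (cong (ℤ._+ (c ℤ.* f (suc k))) (sumTo-scale k c f))
        (sym (ℤP.*-distribˡ-+ c (sumTo k f) (f (suc k))))

sumTo-zero : ∀ k → sumTo k (λ _ → + 0) ≡ + 0
sumTo-zero zero    = refl
sumTo-zero (suc k) = cong (ℤ._+ + 0) (sumTo-zero k)

sumTo-head : ∀ k (f : ℕ → ℤ) → sumTo (suc k) f ≡ f 0 ℤ.+ sumTo k (λ i → f (suc i))
sumTo-head zero    f = refl
sumTo-head (suc k) f =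
  trans (cong (ℤ._+ f (suc (suc k))) (sumTo-head k f)) (ℤP.+-assoc (f 0) _ _)

sumTo-reverse : ∀ k (f : ℕ → ℤ) → sumTo k f ≡ sumTo k (λ i → f (k ∸ i))
sumTo-reverse zero    f = refl
sumTo-reverse (suc k) f = begin
    sumTo k f ℤ.+ f (suc k)
  ≡⟨ cong (ℤ._+ f (suc k)) (sumTo-reverse k f) ⟩
    sumTo k (λ i → f (k ∸ i)) ℤ.+ f (suc k)
  ≡⟨ ℤP.+-comm (sumTo k (λ i → f (k ∸ i))) (f (suc k)) ⟩
    f (suc k) ℤ.+ sumTo k (λ i → f (k ∸ i))
  ≡⟨ sym (sumTo-head k (λ i → f (suc k ∸ i))) ⟩
    sumTo (suc k) (λ i → f (suc k ∸ i)) ∎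
  where open ≡-Reasoning

0P 1P : Poly
0P = constP (+ 0)
1P = constP (+ 1)

0P-coeff : ∀ k → 0P k ≡ + 0
0P-coeff zero    = refl
0P-coeff (suc k) = refl

-- shift p = (p - p(0)) / X
shift : Poly → Poly
shift p i = p (suc i)

*ₚ-suc : ∀ p q k → (p *ₚ q) (suc k) ≡ p 0 ℤ.* q (suc k) ℤ.+ (shift p *ₚ q) k
*ₚ-suc p q k = sumTo-head k (λ i → p i ℤ.* q (suc k ∸ i))

+ₚ-cong : ∀ {p p′ q q′} → p ≈ₚ p′ → q ≈ₚ q′ → (p +ₚ q) ≈ₚ (p′ +ₚ q′)
+ₚ-cong e f k = cong₂ ℤ._+_ (e k) (f k)

*ₚ-cong : ∀ {p p′ q q′} → p ≈ₚ p′ → q ≈ₚ q′ → (p *ₚ q) ≈ₚ (p′ *ₚ q′)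
*ₚ-cong e f k = sumTo-cong k (λ i _ → cong₂ ℤ._*_ (e i) (f (k ∸ i)))

*ₚ-comm : ∀ p q → (p *ₚ q) ≈ₚ (q *ₚ p)
*ₚ-comm p q k = trans (sumTo-reverse k _) (sumTo-cong k swap)
  where
  swap : ∀ i → i ≤ k → p (k ∸ i) ℤ.* q (k ∸ (k ∸ i)) ≡ q i ℤ.* p (k ∸ i)
  swap i i≤k =
    trans (cong (λ j → p (k ∸ i) ℤ.* q j) (ℕP.m∸[m∸n]≡n i≤k)) (ℤP.*-comm (p (k ∸ i)) (q i))

*ₚ-distribʳ : ∀ r p q → ((p +ₚ q) *ₚ r) ≈ₚ ((p *ₚ r) +ₚ (q *ₚ r))
*ₚ-distribʳ r p q k =
  trans (sumTo-cong k (λ i _ → ℤP.*-distribʳ-+ (r (k ∸ i)) (p i) (q i))) (sumTo-+ k _ _)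

scale : ℤ → Poly → Poly
scale c p i = c ℤ.* p i

scale-*ₚ : ∀ c p q → (scale c p *ₚ q) ≈ₚ scale c (p *ₚ q)
scale-*ₚ c p q k =
  trans (sumTo-cong k (λ i _ → ℤP.*-assoc c (p i) (q (k ∸ i)))) (sumTo-scale k c _)

*ₚ-zeroˡ : ∀ q → (0P *ₚ q) ≈ₚ 0P
*ₚ-zeroˡ q k =
  trans (sumTo-cong k (λ i _ → cong (ℤ._* q (k ∸ i)) (0P-coeff i)))
        (trans (sumTo-zero k) (sym (0P-coeff k)))

*ₚ-identityˡ : ∀ q → (1P *ₚ q) ≈ₚ q
*ₚ-identityˡ q zero    = ℤP.*-identityˡ (q 0)
*ₚ-identityˡ q (suc k) =
  trans (*ₚ-suc 1P q k)
        (trans (cong₂ ℤ._+_ (ℤP.*-identityˡ (q (suc k))) shift1-zero) (ℤP.+-identityʳ _))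
  where
  shift1-zero : (shift 1P *ₚ q) k ≡ + 0
  shift1-zero = trans (*ₚ-cong {q = q} (λ i → sym (0P-coeff i)) (λ _ → refl) k) (trans (*ₚ-zeroˡ q k) (0P-coeff k))

*ₚ-assoc : ∀ p q r → ((p *ₚ q) *ₚ r) ≈ₚ (p *ₚ (q *ₚ r))
*ₚ-assoc p q r zero    = ℤP.*-assoc (p 0) (q 0) (r 0)
*ₚ-assoc p q r (suc k) = begin
    ((p *ₚ q) *ₚ r) (suc k)
  ≡⟨ *ₚ-suc (p *ₚ q) r k ⟩
    (p 0 ℤ.* q 0) ℤ.* r (suc k) ℤ.+ (shift (p *ₚ q) *ₚ r) k
  ≡⟨ cong (ℤ._+_ ((p 0 ℤ.* q 0) ℤ.* r (suc k))) shifted ⟩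
    (p 0 ℤ.* q 0) ℤ.* r (suc k) ℤ.+ (p 0 ℤ.* (shift q *ₚ r) k ℤ.+ (shift p *ₚ (q *ₚ r)) k)
  ≡⟨ regroup (p 0) (q 0) (r (suc k)) ((shift q *ₚ r) k) ((shift p *ₚ (q *ₚ r)) k) ⟩
    p 0 ℤ.* (q 0 ℤ.* r (suc k) ℤ.+ (shift q *ₚ r) k) ℤ.+ (shift p *ₚ (q *ₚ r)) k
  ≡⟨ cong (λ z → p 0 ℤ.* z ℤ.+ (shift p *ₚ (q *ₚ r)) k) (sym (*ₚ-suc q r k)) ⟩
    p 0 ℤ.* (q *ₚ r) (suc k) ℤ.+ (shift p *ₚ (q *ₚ r)) k
  ≡⟨ sym (*ₚ-suc p (q *ₚ r) k) ⟩
    (p *ₚ (q *ₚ r)) (suc k) ∎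
  where
  open ≡-Reasoning
  regroup : ∀ x y z u v → (x ℤ.* y) ℤ.* z ℤ.+ (x ℤ.* u ℤ.+ v) ≡ x ℤ.* (y ℤ.* z ℤ.+ u) ℤ.+ v
  regroup x y z u v =
    trans (sym (ℤP.+-assoc ((x ℤ.* y) ℤ.* z) (x ℤ.* u) v))
          (cong (ℤ._+ v) (trans (cong (ℤ._+ x ℤ.* u) (ℤP.*-assoc x y z))
                                (sym (ℤP.*-distribˡ-+ x (y ℤ.* z) u))))
  -- shift (p q) = p_0 (shift q) + (shift p) q
  shifted : (shift (p *ₚ q) *ₚ r) k ≡ p 0 ℤ.* (shift q *ₚ r) k ℤ.+ (shift p *ₚ (q *ₚ r)) k
  shifted =
    trans (*ₚ-cong {q = r} (*ₚ-suc p q) (λ _ → refl) k)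
      (trans (*ₚ-distribʳ r (scale (p 0) (shift q)) (shift p *ₚ q) k)
        (cong₂ ℤ._+_ (scale-*ₚ (p 0) (shift q) r k) (*ₚ-assoc (shift p) q r k)))

-- Coefficientwise equality, wrapped in a record so that both sides can be
-- inferred from it (the bare function type ≈ₚ is not injective).
record _≋_ (p q : Poly) : Set where
  constructor mk
  field get : p ≈ₚ q
open _≋_ public

infix 4 _≋_

open import Algebra.Structures.Biased _≋_ using (isCommutativeSemiringˡ; isCommutativeMonoidˡ)

polySemiring : CommutativeSemiring _ _
polySemiring = record
  { Carrier = Poly ; _≈_ = _≋_ ; _+_ = _+ₚ_ ; _*_ = _*ₚ_ ; 0# = 0P ; 1# = 1P
  ; isCommutativeSemiring = isCommutativeSemiringˡ record
    { +-isCommutativeMonoid = isCommutativeMonoidˡ record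
      { isSemigroup = record
        { isMagma = record { isEquivalence = ≋-isEquivalence
                           ; ∙-cong = λ e f → mk (+ₚ-cong (get e) (get f)) }
        ; assoc = λ p q r → mk (λ k → ℤP.+-assoc (p k) (q k) (r k)) }
      ; identityˡ = λ p → mk (λ k → trans (cong (ℤ._+ p k) (0P-coeff k)) (ℤP.+-identityˡ (p k)))
      ; comm = λ p q → mk (λ k → ℤP.+-comm (p k) (q k)) }
    ; *-isCommutativeMonoid = isCommutativeMonoidˡ record
      { isSemigroup = record
        { isMagma = record { isEquivalence = ≋-isEquivalence
                           ; ∙-cong = λ e f → mk (*ₚ-cong (get e) (get f)) }
        ; assoc = λ p q r → mk (*ₚ-assoc p q r) }
      ; identityˡ = λ q → mk (*ₚ-identityˡ q)
      ; comm = λ p q → mk (*ₚ-comm p q) }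
    ; distribʳ = λ r p q → mk (*ₚ-distribʳ r p q)
    ; zeroˡ = λ q → mk (*ₚ-zeroˡ q) } }
  where
  ≋-isEquivalence : IsEquivalence _≋_
  ≋-isEquivalence = record
    { refl = mk (λ _ → refl)
    ; sym = λ e → mk (λ k → sym (get e k))
    ; trans = λ e f → mk (λ k → trans (get e k) (get f k)) }

module PS = CommutativeSemiring polySemiring
open import Algebra.Solver.Ring.NaturalCoefficients.Default polySemiring
open import Relation.Binary.Reasoning.Setoid PS.setoid

-- Defs' equality on ℚ(X) is cross-multiplication, which is transitive only
-- after cancelling nonzero factors.  We avoid cancellation by working with
-- the finer relation  F ~ G : "F is G with numerator and denominator both
-- multiplied by some polynomial D", which is an honest preorder.

num den : Frac → Poly
num = proj₁
den = proj₂

record _~_ (F G : Frac) : Set where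
  constructor rescaling
  field
    factor    : Poly
    num-scale : num F ≋ num G *ₚ factor
    den-scale : den F ≋ den G *ₚ factor

infix 4 _~_

~-refl : ∀ F → F ~ F
~-refl (p , q) = rescaling 1P (PS.sym (PS.*-identityʳ p)) (PS.sym (PS.*-identityʳ q))

~-reflexive : ∀ {F G} → F ≡ G → F ~ G
~-reflexive {F} refl = ~-refl F

~-trans : ∀ {F G H} → F ~ G → G ~ H → F ~ H
~-trans {H = H} (rescaling D F≋GD F≋GD′) (rescaling E G≋HE G≋HE′) = rescaling (E *ₚ D)
  (PS.trans F≋GD (PS.trans (PS.*-congʳ {D} G≋HE) (PS.*-assoc (num H) E D)))
  (PS.trans F≋GD′ (PS.trans (PS.*-congʳ {D} G≋HE′) (PS.*-assoc (den H) E D)))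

+f-congʳ : ∀ F {G G′} → G ~ G′ → (F +f G) ~ (F +f G′)
+f-congʳ (p , q) {G} {G′} (rescaling D G≋G′D G≋G′D′) = rescaling D
  (begin
     (p *ₚ den G) +ₚ (num G *ₚ q)
   ≈⟨ PS.+-cong (PS.*-congˡ {p} G≋G′D′) (PS.*-congʳ {q} G≋G′D) ⟩
     (p *ₚ (s′ *ₚ D)) +ₚ ((r′ *ₚ D) *ₚ q)
   ≈⟨ solve 5 (λ p s′ r′ q D → p :* (s′ :* D) :+ (r′ :* D) :* q := (p :* s′ :+ r′ :* q) :* D)
              PS.refl p s′ r′ q D ⟩
     ((p *ₚ s′) +ₚ (r′ *ₚ q)) *ₚ D ∎)
  (PS.trans (PS.*-congˡ {q} G≋G′D′) (PS.sym (PS.*-assoc q s′ D)))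
  where
  r′ s′ : Poly
  r′ = num G′
  s′ = den G′

+f-zeroˡ : ∀ Z G → num Z ≋ 0P → (Z +f G) ~ G
+f-zeroˡ (u , w) (r , s) u≋0 = rescaling w
  (PS.trans (PS.+-cong (PS.trans (PS.*-congʳ {s} u≋0) (PS.zeroˡ s)) (PS.refl {r *ₚ w})) (PS.+-identityˡ (r *ₚ w)))
  (PS.*-comm w s)

+f-zeroʳ : ∀ G Z → num Z ≋ 0P → (G +f Z) ~ G
+f-zeroʳ (r , s) (u , w) u≋0 = rescaling w
  (PS.trans (PS.+-cong (PS.refl {r *ₚ w}) (PS.trans (PS.*-congʳ {s} u≋0) (PS.zeroˡ s))) (PS.+-identityʳ (r *ₚ w)))
  (PS.refl {s *ₚ w})

1f-*f : ∀ F → (1f *f F) ~ F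
1f-*f (p , q) = rescaling 1P (PS.trans (PS.*-identityˡ p) (PS.sym (PS.*-identityʳ p)))
                             (PS.trans (PS.*-identityˡ q) (PS.sym (PS.*-identityʳ q)))

fromRescaled : ∀ N {S u d} → S ~ (u , d) → N *ₚ d ≋ u → (N /ₚ 1P) ≈ S
fromRescaled N {S} {u} {d} (rescaling D S≋uD S≋dD) Nd≋u = get (begin
    N *ₚ den S
  ≈⟨ PS.*-congˡ {N} S≋dD ⟩
    N *ₚ (d *ₚ D)
  ≈⟨ PS.sym (PS.*-assoc N d D) ⟩
    (N *ₚ d) *ₚ D
  ≈⟨ PS.*-congʳ {D} Nd≋u ⟩
    u *ₚ D
  ≈⟨ PS.sym S≋uD ⟩
    num S
  ≈⟨ PS.sym (PS.*-identityʳ (num S)) ⟩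
    num S *ₚ 1P ∎)

sum-zero : ∀ n (T : Fin n → Frac) → (∀ j → num (T j) ≋ 0P) → num (sumFin n T) ≋ 0P
sum-zero zero    T T≋0 = PS.refl
sum-zero (suc n) T T≋0 = begin
    (num (T fzero) *ₚ den R) +ₚ (num R *ₚ den (T fzero))
  ≈⟨ PS.+-cong (PS.trans (PS.*-congʳ {den R} (T≋0 fzero)) (PS.zeroˡ (den R)))
               (PS.trans (PS.*-congʳ {den (T fzero)} (sum-zero n (λ j → T (fsuc j)) (λ j → T≋0 (fsuc j))))
                         (PS.zeroˡ (den (T fzero)))) ⟩
    0P +ₚ 0P
  ≈⟨ PS.+-identityˡ 0P ⟩
    0P ∎
  where
  R : Frac
  R = sumFin n (λ j → T (fsuc j))

sum-single : ∀ n (k : Fin n) (T : Fin n → Frac) →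
             (∀ j → toℕ j ≢ toℕ k → num (T j) ≋ 0P) → sumFin n T ~ T k
sum-single (suc n) fzero    T T≋0 =
  +f-zeroʳ (T fzero) (sumFin n (λ j → T (fsuc j))) (sum-zero n (λ j → T (fsuc j)) (λ j → T≋0 (fsuc j) (λ ())))
sum-single (suc n) (fsuc k) T T≋0 =
  ~-trans (+f-zeroˡ (T fzero) (sumFin n (λ j → T (fsuc j))) (T≋0 fzero (λ ())))
          (sum-single n k (λ j → T (fsuc j)) (λ j j≢k → T≋0 (fsuc j) (j≢k ∘ ℕP.suc-injective)))

sum-adjacent : ∀ n (i : Fin n) (T : Fin (suc n) → Frac) →
               (∀ j → toℕ j ≢ toℕ i → toℕ j ≢ suc (toℕ i) → num (T j) ≋ 0P) →
               sumFin (suc n) T ~ (T (inject₁ i) +f T (fsuc i))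
sum-adjacent (suc n) fzero    T T≋0 =
  +f-congʳ (T fzero) (sum-single (suc n) fzero (λ j → T (fsuc j))
                                 (λ j j≢0 → T≋0 (fsuc j) (λ ()) (j≢0 ∘ ℕP.suc-injective)))
sum-adjacent (suc n) (fsuc i) T T≋0 =
  ~-trans (+f-zeroˡ (T fzero) (sumFin (suc n) (λ j → T (fsuc j))) (T≋0 fzero (λ ()) (λ ())))
          (sum-adjacent n i (λ j → T (fsuc j))
                        (λ j j≢i j≢1+i → T≋0 (fsuc j) (j≢i ∘ ℕP.suc-injective) (j≢1+i ∘ ℕP.suc-injective)))

L-diagonal : ∀ n (i j : Fin n) → toℕ i ≡ toℕ j → Lmat n i j ≡ 1f
L-diagonal n i j i≡j with toℕ i ℕ.≟ toℕ j
... | yes _   = refl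
... | no i≢j  = ⊥-elim (i≢j i≡j)

L-subdiagonal : ∀ n (i j : Fin n) → toℕ i ≡ suc (toℕ j) → Lmat n i j ≡ (Lnum (toℕ i) /ₚ Lden (toℕ i))
L-subdiagonal n i j i≡1+j with toℕ i ℕ.≟ toℕ j
... | yes i≡j = ⊥-elim (ℕP.1+n≢n (trans (sym i≡1+j) i≡j))
... | no _ with toℕ i ℕ.≟ suc (toℕ j)
...   | yes _    = refl
...   | no i≢1+j = ⊥-elim (i≢1+j i≡1+j)

L-zero : ∀ n (i j : Fin n) → toℕ i ≢ toℕ j → toℕ i ≢ suc (toℕ j) → Lmat n i j ≡ 0f
L-zero n i j i≢j i≢1+j with toℕ i ℕ.≟ toℕ j
... | yes i≡j = ⊥-elim (i≢j i≡j)
... | no _ with toℕ i ℕ.≟ suc (toℕ j)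
...   | yes i≡1+j = ⊥-elim (i≢1+j i≡1+j)
...   | no _      = refl

LU-summand-zero : ∀ n (i j l : Fin n) → toℕ j ≢ toℕ i → toℕ i ≢ suc (toℕ j) →
                  num (Lmat n i j *f Umat n j l) ≋ 0P
LU-summand-zero n i j l j≢i i≢1+j rewrite L-zero n i j (λ i≡j → j≢i (sym i≡j)) i≢1+j =
  PS.zeroˡ (num (Umat n j l))

binom-pascal : ∀ m k → binom (suc m) (suc k) ≡ binom m k ℤ.+ binom m (suc k)
binom-pascal m k = cong +_ (sym (nCk+nC[k+1]≡[n+1]C[k+1] m k))

-- Pascal's rule with the indices written as they occur in a_j, U and N.
binom-pascal-odd : ∀ m k → binom (suc m) (k ℕ.+ 1) ≡ binom m (k ℕ.+ 1) ℤ.+ binom m k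
binom-pascal-odd m k rewrite ℕP.+-comm k 1 = trans (binom-pascal m k) (ℤP.+-comm (binom m k) (binom m (suc k)))

binom-pascal-+1 : ∀ m k → binom (m ℕ.+ 1) (k ℕ.+ 1) ≡ binom m k ℤ.+ binom m (suc k)
binom-pascal-+1 m k rewrite ℕP.+-comm m 1 | ℕP.+-comm k 1 = binom-pascal m k

binom-pascal-+2 : ∀ m k → binom (m ℕ.+ 2) (suc k) ≡ binom (m ℕ.+ 1) k ℤ.+ binom (m ℕ.+ 1) (suc k)
binom-pascal-+2 m k = trans (cong (λ n → binom n (suc k)) (ℕP.+-suc m 1)) (binom-pascal (m ℕ.+ 1) k)

binom-vanish : ∀ {m k} → m < k → binom m k ≡ + 0
binom-vanish m<k = cong +_ (k>n⇒nCk≡0 m<k)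

constP-+ : ∀ {x y z} → x ≡ y ℤ.+ z → constP x ≋ constP y +ₚ constP z
constP-+ refl = mk λ { zero → refl ; (suc k) → refl }

Xp-shift : ∀ p h → (Xp *ₚ p) (suc h) ≡ p h
Xp-shift p h =
  trans (*ₚ-suc Xp p h)
        (trans (ℤP.+-identityˡ _) (trans (*ₚ-cong {q = p} shift-Xp (λ _ → refl) h) (*ₚ-identityˡ p h)))
  where
  shift-Xp : shift Xp ≈ₚ 1P
  shift-Xp zero    = refl
  shift-Xp (suc k) = refl

a-zero : a 0 ≋ 1P
a-zero = mk λ { zero → refl ; (suc h) → binom-vanish (h+2<2h+3 h) }
  where
  h+2<2h+3 : ∀ h → suc (suc h) < 2 ℕ.* suc h ℕ.+ 1
  h+2<2h+3 h = ℕP.≤-trans (s≤s (s≤s (ℕP.≤-trans (s≤s (ℕP.m≤m+n h 0)) (ℕP.m≤n+m _ h))))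
                          (ℕP.≤-reflexive (ℕP.+-comm 1 (2 ℕ.* suc h)))

b-zero : b 0 ≋ 1P +ₚ Xp
b-zero = mk λ { zero → refl ; (suc zero) → refl ; (suc (suc h)) → binom-vanish (h+3<2h+4 h) }
  where
  h+3<2h+4 : ∀ h → suc (suc (suc h)) < 2 ℕ.* suc (suc h)
  h+3<2h+4 h = s≤s (s≤s (ℕP.≤-trans (ℕP.m≤n+m (suc (suc h)) h)
                                    (ℕP.≤-reflexive (cong (h ℕ.+_) (sym (ℕP.*-identityˡ (suc (suc h))))))))

a-step : ∀ t → a (suc t) ≋ a t +ₚ b t
a-step t = mk λ h → binom-pascal-odd (t ℕ.+ 1 ℕ.+ h) (2 ℕ.* h)

b-step : ∀ t → b (suc t) ≋ b t +ₚ (Xp *ₚ a (suc t))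
b-step t = mk λ { zero → refl ; (suc h) → coefficient h }
  where
  coefficient : ∀ h → b (suc t) (suc h) ≡ b t (suc h) ℤ.+ (Xp *ₚ a (suc t)) (suc h)
  coefficient h =
    trans (binom-pascal n k)
      (trans (ℤP.+-comm (binom n k) (binom n (suc k)))
             (cong (ℤ._+_ (binom n (suc k))) (sym (trans (Xp-shift (a (suc t)) h) (cong₂ binom n≡ k≡)))))
    where
    n k : ℕ
    n = t ℕ.+ 1 ℕ.+ suc h
    k = h ℕ.+ suc (h ℕ.+ 0)
    n≡ : suc t ℕ.+ 1 ℕ.+ h ≡ n
    n≡ = sym (ℕP.+-suc (t ℕ.+ 1) h)
    k≡ : 2 ℕ.* h ℕ.+ 1 ≡ k
    k≡ = trans (ℕP.+-comm (2 ℕ.* h) 1) (sym (ℕP.+-suc h (h ℕ.+ 0)))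

Lnum-suc : ∀ t → Lnum (suc t) ≋ a t
Lnum-suc t = mk λ h → cong (λ m → binom (m ℕ.+ h) (2 ℕ.* h ℕ.+ 1)) (ℕP.+-comm 1 t)

Unum : ℕ → ℕ → Poly
Unum t l = (constP (binom (l ℕ.+ 1) (t ℕ.+ 1)) *ₚ a t) +ₚ (constP (binom l t) *ₚ b t)

Nnum : ℕ → ℕ → Poly
Nnum t l = (constP (binom l t) *ₚ Xp) +ₚ constP (binom (l ℕ.+ 2) (t ℕ.+ 1))

first-row-core : ∀ A B K K′ → A ≋ 1P → B ≋ 1P +ₚ Xp → K′ ≋ 1P +ₚ K →
                 ((1P *ₚ Xp) +ₚ K′) *ₚ A ≋ (K *ₚ A) +ₚ (1P *ₚ B)
first-row-core A B K K′ A≋1 B≋1+X K′≋1+K = begin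
    ((1P *ₚ Xp) +ₚ K′) *ₚ A
  ≈⟨ PS.*-cong (PS.+-congˡ {1P *ₚ Xp} K′≋1+K) A≋1 ⟩
    ((1P *ₚ Xp) +ₚ (1P +ₚ K)) *ₚ 1P
  ≈⟨ solve 2 (λ X K → ((con 1 :* X) :+ (con 1 :+ K)) :* con 1 := (K :* con 1) :+ (con 1 :* (con 1 :+ X)))
             PS.refl Xp K ⟩
    (K *ₚ 1P) +ₚ (1P *ₚ (1P +ₚ Xp))
  ≈⟨ PS.sym (PS.+-cong (PS.*-congˡ {K} A≋1) (PS.*-congˡ {1P} B≋1+X)) ⟩
    (K *ₚ A) +ₚ (1P *ₚ B) ∎

first-row : ∀ l → Nnum 0 l *ₚ a 0 ≋ Unum 0 l
first-row l = first-row-core (a 0) (b 0) (constP (binom (l ℕ.+ 1) 1)) (constP (binom (l ℕ.+ 2) 1))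
                            a-zero b-zero (constP-+ (binom-pascal-+2 l 0))

next-row-core : ∀ A B A′ B′ c₁ c₂ c₃ c₄ c₅ →
  A′ ≋ A +ₚ B → B′ ≋ B +ₚ (Xp *ₚ A′) → c₄ ≋ c₂ +ₚ c₁ → c₅ ≋ c₄ +ₚ c₃ →
  ((c₁ *ₚ Xp) +ₚ c₅) *ₚ A′ ≋ ((c₄ *ₚ A) +ₚ (c₂ *ₚ B)) +ₚ ((c₃ *ₚ A′) +ₚ (c₁ *ₚ B′))
next-row-core A B A′ B′ c₁ c₂ c₃ c₄ c₅ A′≋ B′≋ c₄≋ c₅≋ = begin
    ((c₁ *ₚ Xp) +ₚ c₅) *ₚ A′
  ≈⟨ PS.*-congʳ {A′} (PS.+-congˡ {c₁ *ₚ Xp} (PS.trans c₅≋ (PS.+-congʳ {c₃} c₄≋))) ⟩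
    ((c₁ *ₚ Xp) +ₚ ((c₂ +ₚ c₁) +ₚ c₃)) *ₚ A′
  ≈⟨ solve 5 (λ X c₁ c₂ c₃ A′ → ((c₁ :* X) :+ ((c₂ :+ c₁) :+ c₃)) :* A′
                               := ((c₁ :* X) :+ c₃) :* A′ :+ (c₂ :+ c₁) :* A′)
             PS.refl Xp c₁ c₂ c₃ A′ ⟩
    (((c₁ *ₚ Xp) +ₚ c₃) *ₚ A′) +ₚ ((c₂ +ₚ c₁) *ₚ A′)
  ≈⟨ PS.+-congˡ {((c₁ *ₚ Xp) +ₚ c₃) *ₚ A′} (PS.*-congˡ {c₂ +ₚ c₁} A′≋) ⟩
    (((c₁ *ₚ Xp) +ₚ c₃) *ₚ A′) +ₚ ((c₂ +ₚ c₁) *ₚ (A +ₚ B))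
  ≈⟨ solve 7 (λ X c₁ c₂ c₃ A B A′ →
               ((c₁ :* X) :+ c₃) :* A′ :+ (c₂ :+ c₁) :* (A :+ B)
               := ((c₂ :+ c₁) :* A :+ c₂ :* B) :+ (c₃ :* A′ :+ c₁ :* (B :+ X :* A′)))
             PS.refl Xp c₁ c₂ c₃ A B A′ ⟩
    (((c₂ +ₚ c₁) *ₚ A) +ₚ (c₂ *ₚ B)) +ₚ ((c₃ *ₚ A′) +ₚ (c₁ *ₚ (B +ₚ (Xp *ₚ A′))))
  ≈⟨ PS.sym (PS.+-cong (PS.+-congʳ {c₂ *ₚ B} (PS.*-congʳ {A} c₄≋))
                       (PS.+-congˡ {c₃ *ₚ A′} (PS.*-congˡ {c₁} B′≋))) ⟩
    ((c₄ *ₚ A) +ₚ (c₂ *ₚ B)) +ₚ ((c₃ *ₚ A′) +ₚ (c₁ *ₚ B′)) ∎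

next-row : ∀ t l → Nnum (suc t) l *ₚ a (suc t) ≋ Unum t l +ₚ Unum (suc t) l
next-row t l =
  next-row-core (a t) (b t) (a (suc t)) (b (suc t))
                (constP (binom l (suc t))) (constP (binom l t)) (constP (binom (l ℕ.+ 1) (suc t ℕ.+ 1)))
                (constP (binom (l ℕ.+ 1) (t ℕ.+ 1))) (constP (binom (l ℕ.+ 2) (suc t ℕ.+ 1)))
                (a-step t) (b-step t) (constP-+ (binom-pascal-+1 l t)) (constP-+ (binom-pascal-+2 l (t ℕ.+ 1)))

next-row-fraction : ∀ p A A′ u u′ → p ≋ A →
                    ((p /ₚ A′) *f (u /ₚ A)) +f (1f *f (u′ /ₚ A′)) ~ ((u +ₚ u′) /ₚ A′)
next-row-fraction p A A′ u u′ p≋A = rescaling (A *ₚ A′)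
  (begin
     ((p *ₚ u) *ₚ (1P *ₚ A′)) +ₚ ((1P *ₚ u′) *ₚ (A′ *ₚ A))
   ≈⟨ PS.+-congʳ {(1P *ₚ u′) *ₚ (A′ *ₚ A)} (PS.*-congʳ {1P *ₚ A′} (PS.*-congʳ {u} p≋A)) ⟩
     ((A *ₚ u) *ₚ (1P *ₚ A′)) +ₚ ((1P *ₚ u′) *ₚ (A′ *ₚ A))
   ≈⟨ solve 4 (λ A A′ u u′ → (A :* u) :* (con 1 :* A′) :+ (con 1 :* u′) :* (A′ :* A)
                            := (u :+ u′) :* (A :* A′))
              PS.refl A A′ u u′ ⟩
     (u +ₚ u′) *ₚ (A *ₚ A′) ∎)
  (solve 2 (λ A A′ → (A′ :* A) :* (con 1 :* A′) := A′ :* (A :* A′)) PS.refl A A′)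

first-row-LU : ∀ n (l : Fin (suc n)) → (Lmat (suc n) ⊗ Umat (suc n)) fzero l ~ Umat (suc n) fzero l
first-row-LU n l =
  ~-trans (sum-single (suc n) fzero T (λ j j≢0 → LU-summand-zero (suc n) fzero j l j≢0 (λ ())))
          (~-trans (~-reflexive (cong (_*f Umat (suc n) fzero l) (L-diagonal (suc n) fzero fzero refl)))
                   (1f-*f (Umat (suc n) fzero l)))
  where
  T : Fin (suc n) → Frac
  T j = Lmat (suc n) fzero j *f Umat (suc n) j l

next-row-LU : ∀ n (i : Fin n) (l : Fin (suc n)) →
              (Lmat (suc n) ⊗ Umat (suc n)) (fsuc i) l ~
              ((Unum (toℕ i) (toℕ l) +ₚ Unum (suc (toℕ i)) (toℕ l)) /ₚ a (suc (toℕ i)))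
next-row-LU n i l =
  ~-trans (sum-adjacent n i T vanishing)
          (~-trans (~-reflexive (cong₂ _+f_ subdiagonal diagonal))
                   (next-row-fraction (Lnum (suc t)) (a t) (a (suc t)) (Unum t L) (Unum (suc t) L) (Lnum-suc t)))
  where
  t L : ℕ
  t = toℕ i
  L = toℕ l
  T : Fin (suc n) → Frac
  T j = Lmat (suc n) (fsuc i) j *f Umat (suc n) j l
  vanishing : ∀ j → toℕ j ≢ t → toℕ j ≢ suc t → num (T j) ≋ 0P
  vanishing j j≢t j≢1+t = LU-summand-zero (suc n) (fsuc i) j l j≢1+t (λ e → j≢t (sym (ℕP.suc-injective e)))
  subdiagonal : T (inject₁ i) ≡ (Lnum (suc t) /ₚ a (suc t)) *f (Unum t L /ₚ a t)
  subdiagonal = cong₂ _*f_ (L-subdiagonal (suc n) (fsuc i) (inject₁ i) (cong suc (sym (toℕ-inject₁ i))))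
                           (cong (λ j → Unum j L /ₚ a j) (toℕ-inject₁ i))
  diagonal : T (fsuc i) ≡ 1f *f (Unum (suc t) L /ₚ a (suc t))
  diagonal = cong (_*f Umat (suc n) (fsuc i) l) (L-diagonal (suc n) (fsuc i) (fsuc i) refl)

mainTheorem11 : (n : ℕ) → 0 < n → (i l : Fin n) → Nmat n i l ≈ (Lmat n ⊗ Umat n) i l
mainTheorem11 (suc n) _ fzero    l = fromRescaled (Nnum 0 (toℕ l)) (first-row-LU n l) (first-row (toℕ l))
mainTheorem11 (suc n) _ (fsuc i) l =
  fromRescaled (Nnum (suc (toℕ i)) (toℕ l)) (next-row-LU n i l) (next-row (toℕ i) (toℕ l))
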